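{- The minimum size of a universal instance is $12$: every universal instance has size at least $12$, and there exists a universal instance of size $12$.
   Context: Fix a palette of six distinct colors. A (colored) cube is a unit cube each of whose six faces is painted with exactly one color of the palette, all six faces receiving different colors. Two colored cubes have the same variety if one can be rotated onto the other; there are exactly 30 varieties. An instance is a finite multiset of colored cubes (several cubes of the same variety are allowed); its size is the number of cubes counted with multiplicity. A solid is a $2\times2\times2$ cube assembled from eight colored unit cubes such that each of its six outer $2\times2$ faces is of a single color and the six outer faces have six different colors; its variety is defined as for unit cubes. A solid of variety $v$ is composable from an instance $I$ if some eight cubes of $I$ can be placed and oriented to form a solid of variety $v$. An instance is universal if a solid of every one of the 30 varieties is composable from it. -}

module Defs where

open import Data.Bool using (Bool; true; false; not)
open import Data.Fin using (Fin)
open import Data.Nat using (ℕ)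
open import Data.List using (List; length; lookup)
open import Data.Product using (Σ; ∃; _×_; _,_)
open import Function.Definitions using (Injective)
open import Relation.Binary.PropositionalEquality using (_≡_)

Color : Set
Color = Fin 6

data Axis : Set where
  X Y Z : Axis

-- A face direction of a (unit or 2×2×2) cube: an axis and a side
-- (true = positive side, false = negative side).
Face : Set
Face = Axis × Bool

-- Rotations of the cube, as words in the two quarter turns about the
-- x-axis and the y-axis; these generate the full rotation group (order 24).
data Rot : Set where
  idR : Rot
  rx  : Rot → Rot
  ry  : Rot → Rot

qx : Face → Face
qx (X , s) = X , s
qx (Y , s) = Z , s
qx (Z , s) = Y , not s

qy : Face → Face
qy (X , s) = Z , not s
qy (Y , s) = Y , s
qy (Z , s) = X , s

act : Rot → Face → Face
act idR   f = f
act (rx r) f = qx (act r f)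
act (ry r) f = qy (act r f)

Coloring : Set
Coloring = Face → Color

record Cube : Set where
  constructor cube
  field
    col   : Coloring
    col-injective : Injective _≡_ _≡_ col
open Cube public

rotate : Rot → Coloring → Coloring
rotate r c f = c (act r f)

SameVariety : Coloring → Coloring → Set
SameVariety c d = ∃ λ (r : Rot) → ∀ f → d f ≡ rotate r c f

-- An instance: a finite multiset of cubes, represented as a list
-- (order irrelevant); its size is the length.
Instance : Set
Instance = List Cube

size : Instance → ℕ
size = length

-- The eight cells of a 2×2×2 cube: one side (false/true) per axis.
Corner : Set
Corner = Bool × Bool × Bool

side : Corner → Axis → Bool
side (a , b , c) X = a
side (a , b , c) Y = b
side (a , b , c) Z = c

-- A solid of variety v is composable from I: eight distinct cubes of I
-- (an injective choice of list positions), each placed in a cell and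
-- oriented by a rotation, such that every outer 2×2 face is of a single
-- colour, the six outer faces have six different colours (given by an
-- injective colouring `big` of the big cube's faces), and the resulting
-- solid has the same variety as v.
Composable : (I : Instance) → Cube → Set
Composable I v =
  Σ (Corner → Fin (length I)) λ sel → Injective _≡_ _≡_ sel ×
  Σ (Corner → Rot) λ orient →
  Σ Coloring λ big → Injective _≡_ _≡_ big ×
    (∀ (p : Corner) (a : Axis) →
       rotate (orient p) (col (lookup I (sel p))) (a , side p a) ≡ big (a , side p a)) ×
    SameVariety big (col v)

Universal : Instance → Set
Universal I = ∀ (v : Cube) → Composable I v

module Submission where

-- A vertex of a colored cube is the triple of colors around one of its corners, up to cyclic order.
-- Rotations permute vertices, and each cell of a solid shows at its outer corner a vertex of the solid,
-- so every one of the eight cubes of a solid of variety v shares a vertex with v: in a universal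
-- instance each of the 30 varieties shares a vertex with at least 8 cubes. An exhaustive computation
-- shows that a cube shares a vertex with at most 21 varieties, so counting the sharing pairs both ways
-- gives 8 · 30 ≤ 21 · n, i.e. n ≥ 12. Conversely, twelve of the thirty varieties, with an explicit
-- assembly for every target variety, form a universal instance.

open import Defs
open import Data.Nat using (ℕ; _≤_; _+_; _*_; z≤n; _≤?_)
open import Data.Product using (Σ; _×_; ∃; Σ-syntax; _,_; proj₁; proj₂)
open import Relation.Binary.PropositionalEquality using (_≡_; refl; sym; trans; cong; subst; module ≡-Reasoning)

open import Data.Bool using (true; false; if_then_else_; _xor_)
open import Data.Bool.Properties using (not-involutive)
open import Data.Fin as Fin using (Fin; zero; suc; #_)
open import Data.Fin.Properties using (all?; any?; injective⇒≤; suc-injective)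
open import Data.List as List using (List; []; _∷_; length; allFin)
open import Data.Nat.ListAction using (sum)
open import Data.Nat.Properties
  using (module ≤-Reasoning; ≤-refl; ≤-reflexive; ≤-trans; ≤-pred; ≮⇒≥; +-mono-≤; *-zeroʳ; *-suc; *-monoʳ-≤;
         +-commutativeSemigroup)
open import Algebra.Properties.CommutativeSemigroup +-commutativeSemigroup using (interchange)
open import Data.Product.Properties using (≡-dec)
open import Data.Sum using (_⊎_; inj₁; inj₂)
open import Data.Vec as Vec using (Vec; []; _∷_; tabulate)
open import Data.Vec.Properties using (lookup∘tabulate)
open import Data.Vec.Relation.Unary.All as All using ()
open import Data.Vec.Relation.Unary.Unique.Propositional using (Unique; []; _∷_)
open import Data.Vec.Relation.Unary.Unique.Propositional.Properties using (tabulate⁺)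
open import Function using (_∘_)
open import Function.Definitions using (Injective)
open import Relation.Binary.Definitions using (DecidableEquality)
open import Relation.Nullary using (Dec; does; yes; no; map′; ¬?; _×-dec_; _⊎-dec_; _→-dec_; contradiction)
open import Relation.Nullary.Decidable using (toWitness; from-no)
open import Relation.Unary using (Pred; Decidable)

module Enumeration {A : Set} {n : ℕ} (enum : Fin n → A) (index : A → Fin n)
                   (enum-index : ∀ a → enum (index a) ≡ a)
                   (index-enum : ∀ i → index (enum i) ≡ i) where

  enum-injective : Injective _≡_ _≡_ enum
  enum-injective {i} {j} e = begin
    i                ≡⟨ index-enum i ⟨
    index (enum i)   ≡⟨ cong index e ⟩
    index (enum j)   ≡⟨ index-enum j ⟩
    j                ∎
    where open ≡-Reasoning

  index-injective : Injective _≡_ _≡_ index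
  index-injective {a} {b} e = begin
    a                ≡⟨ enum-index a ⟨
    enum (index a)   ≡⟨ cong enum e ⟩
    enum (index b)   ≡⟨ enum-index b ⟩
    b                ∎
    where open ≡-Reasoning

  _≟_ : DecidableEquality A
  a ≟ b = map′ index-injective (cong index) (index a Fin.≟ index b)

  ∀? : ∀ {p} {P : Pred A p} → Decidable P → Dec (∀ a → P a)
  ∀? {P = P} P? = map′ (λ h a → subst P (enum-index a) (h (index a))) (λ h → h ∘ enum) (all? (P? ∘ enum))

  ∃? : ∀ {p} {P : Pred A p} → Decidable P → Dec (∃ P)
  ∃? {P = P} P? = map′ (λ (i , h) → enum i , h) (λ (a , h) → index a , subst P (sym (enum-index a)) h)
                       (any? (P? ∘ enum))

  injective? : ∀ {B : Set} → DecidableEquality B → (f : A → B) → Dec (Injective _≡_ _≡_ f)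
  injective? _≟ᴮ_ f = map′ (λ h → h _ _) (λ h _ _ → h) (∀? λ a → ∀? λ b → f a ≟ᴮ f b →-dec a ≟ b)

axisAt : Fin 3 → Axis
axisAt zero = X
axisAt (suc zero) = Y
axisAt (suc (suc zero)) = Z

axisIndex : Axis → Fin 3
axisIndex X = # 0
axisIndex Y = # 1
axisIndex Z = # 2

axisAt-axisIndex : ∀ a → axisAt (axisIndex a) ≡ a
axisAt-axisIndex X = refl
axisAt-axisIndex Y = refl
axisAt-axisIndex Z = refl

axisIndex-axisAt : ∀ i → axisIndex (axisAt i) ≡ i
axisIndex-axisAt zero = refl
axisIndex-axisAt (suc zero) = refl
axisIndex-axisAt (suc (suc zero)) = refl

faceAt : Fin 6 → Face
faceAt zero = X , true
faceAt (suc zero) = X , false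
faceAt (suc (suc zero)) = Y , true
faceAt (suc (suc (suc zero))) = Y , false
faceAt (suc (suc (suc (suc zero)))) = Z , true
faceAt (suc (suc (suc (suc (suc zero))))) = Z , false

faceIndex : Face → Fin 6
faceIndex (X , true) = # 0
faceIndex (X , false) = # 1
faceIndex (Y , true) = # 2
faceIndex (Y , false) = # 3
faceIndex (Z , true) = # 4
faceIndex (Z , false) = # 5

faceAt-faceIndex : ∀ f → faceAt (faceIndex f) ≡ f
faceAt-faceIndex (X , true) = refl
faceAt-faceIndex (X , false) = refl
faceAt-faceIndex (Y , true) = refl
faceAt-faceIndex (Y , false) = refl
faceAt-faceIndex (Z , true) = refl
faceAt-faceIndex (Z , false) = refl

faceIndex-faceAt : ∀ i → faceIndex (faceAt i) ≡ i
faceIndex-faceAt zero = refl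
faceIndex-faceAt (suc zero) = refl
faceIndex-faceAt (suc (suc zero)) = refl
faceIndex-faceAt (suc (suc (suc zero))) = refl
faceIndex-faceAt (suc (suc (suc (suc zero)))) = refl
faceIndex-faceAt (suc (suc (suc (suc (suc zero))))) = refl

cornerAt : Fin 8 → Corner
cornerAt zero = true , true , true
cornerAt (suc zero) = true , true , false
cornerAt (suc (suc zero)) = true , false , true
cornerAt (suc (suc (suc zero))) = true , false , false
cornerAt (suc (suc (suc (suc zero)))) = false , true , true
cornerAt (suc (suc (suc (suc (suc zero))))) = false , true , false
cornerAt (suc (suc (suc (suc (suc (suc zero)))))) = false , false , true
cornerAt (suc (suc (suc (suc (suc (suc (suc zero))))))) = false , false , false

cornerIndex : Corner → Fin 8
cornerIndex (true , true , true) = # 0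
cornerIndex (true , true , false) = # 1
cornerIndex (true , false , true) = # 2
cornerIndex (true , false , false) = # 3
cornerIndex (false , true , true) = # 4
cornerIndex (false , true , false) = # 5
cornerIndex (false , false , true) = # 6
cornerIndex (false , false , false) = # 7

cornerAt-cornerIndex : ∀ p → cornerAt (cornerIndex p) ≡ p
cornerAt-cornerIndex (true , true , true) = refl
cornerAt-cornerIndex (true , true , false) = refl
cornerAt-cornerIndex (true , false , true) = refl
cornerAt-cornerIndex (true , false , false) = refl
cornerAt-cornerIndex (false , true , true) = refl
cornerAt-cornerIndex (false , true , false) = refl
cornerAt-cornerIndex (false , false , true) = refl
cornerAt-cornerIndex (false , false , false) = refl

cornerIndex-cornerAt : ∀ i → cornerIndex (cornerAt i) ≡ i
cornerIndex-cornerAt zero = refl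
cornerIndex-cornerAt (suc zero) = refl
cornerIndex-cornerAt (suc (suc zero)) = refl
cornerIndex-cornerAt (suc (suc (suc zero))) = refl
cornerIndex-cornerAt (suc (suc (suc (suc zero)))) = refl
cornerIndex-cornerAt (suc (suc (suc (suc (suc zero))))) = refl
cornerIndex-cornerAt (suc (suc (suc (suc (suc (suc zero)))))) = refl
cornerIndex-cornerAt (suc (suc (suc (suc (suc (suc (suc zero))))))) = refl

module Axes = Enumeration axisAt axisIndex axisAt-axisIndex axisIndex-axisAt
module Faces = Enumeration faceAt faceIndex faceAt-faceIndex faceIndex-faceAt
module Corners = Enumeration cornerAt cornerIndex cornerAt-cornerIndex cornerIndex-cornerAt

coloring : Vec Color 6 → Coloring
coloring v f = Vec.lookup v (faceIndex f)

coloring-tabulate : ∀ c f → coloring (tabulate (c ∘ faceAt)) f ≡ c f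
coloring-tabulate c f = trans (lookup∘tabulate (c ∘ faceAt) (faceIndex f)) (cong c (faceAt-faceIndex f))

-- The search prunes each partial vector as soon as it repeats an entry.
∀-unique? : ∀ {m n p} {P : Pred (Vec (Fin m) n) p} → Decidable P → Dec (∀ xs → Unique xs → P xs)
∀-unique? {n = ℕ.zero} P? = map′ (λ { h [] [] → h }) (λ h → h [] []) (P? [])
∀-unique? {n = ℕ.suc n} P? =
  map′ (λ { h (x ∷ xs) (x∉xs ∷ u) → h xs u x x∉xs }) (λ h xs u x x∉xs → h (x ∷ xs) (x∉xs ∷ u))
       (∀-unique? λ xs → all? λ x → All.all? (λ y → ¬? (x Fin.≟ y)) xs →-dec P? (x ∷ xs))

rotations : Vec Rot 24
rotations =
  idR ∷ rx idR ∷ ry idR ∷ rx (rx idR) ∷ ry (rx idR) ∷ rx (ry idR) ∷ ry (ry idR) ∷ rx (rx (rx idR)) ∷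
  ry (rx (rx idR)) ∷ rx (ry (rx idR)) ∷ ry (ry (rx idR)) ∷ rx (rx (ry idR)) ∷ rx (ry (ry idR)) ∷
  ry (ry (ry idR)) ∷ ry (rx (rx (rx idR))) ∷ rx (ry (rx (rx idR))) ∷ ry (ry (rx (rx idR))) ∷
  rx (rx (ry (rx idR))) ∷ ry (ry (ry (rx idR))) ∷ rx (rx (rx (ry idR))) ∷ rx (ry (ry (ry idR))) ∷
  rx (ry (rx (rx (rx idR)))) ∷ rx (rx (rx (ry (rx idR)))) ∷ rx (ry (ry (ry (rx idR)))) ∷ []

table : (a b c d e f : Color) → Vec Color 6
table a b c d e f = a ∷ b ∷ c ∷ d ∷ e ∷ f ∷ []

-- One coloring per variety, listing the faces +x, −x, +y, −y, +z, −z: color 0 on +x and,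
-- on +y, the smallest color not opposite to it.
representatives : Vec (Vec Color 6) 30
representatives =
  table (# 0) (# 1) (# 2) (# 3) (# 4) (# 5) ∷ table (# 0) (# 1) (# 2) (# 3) (# 5) (# 4) ∷
  table (# 0) (# 1) (# 2) (# 4) (# 3) (# 5) ∷ table (# 0) (# 1) (# 2) (# 4) (# 5) (# 3) ∷
  table (# 0) (# 1) (# 2) (# 5) (# 3) (# 4) ∷ table (# 0) (# 1) (# 2) (# 5) (# 4) (# 3) ∷
  table (# 0) (# 2) (# 1) (# 3) (# 4) (# 5) ∷ table (# 0) (# 2) (# 1) (# 3) (# 5) (# 4) ∷
  table (# 0) (# 2) (# 1) (# 4) (# 3) (# 5) ∷ table (# 0) (# 2) (# 1) (# 4) (# 5) (# 3) ∷
  table (# 0) (# 2) (# 1) (# 5) (# 3) (# 4) ∷ table (# 0) (# 2) (# 1) (# 5) (# 4) (# 3) ∷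
  table (# 0) (# 3) (# 1) (# 2) (# 4) (# 5) ∷ table (# 0) (# 3) (# 1) (# 2) (# 5) (# 4) ∷
  table (# 0) (# 3) (# 1) (# 4) (# 2) (# 5) ∷ table (# 0) (# 3) (# 1) (# 4) (# 5) (# 2) ∷
  table (# 0) (# 3) (# 1) (# 5) (# 2) (# 4) ∷ table (# 0) (# 3) (# 1) (# 5) (# 4) (# 2) ∷
  table (# 0) (# 4) (# 1) (# 2) (# 3) (# 5) ∷ table (# 0) (# 4) (# 1) (# 2) (# 5) (# 3) ∷
  table (# 0) (# 4) (# 1) (# 3) (# 2) (# 5) ∷ table (# 0) (# 4) (# 1) (# 3) (# 5) (# 2) ∷
  table (# 0) (# 4) (# 1) (# 5) (# 2) (# 3) ∷ table (# 0) (# 4) (# 1) (# 5) (# 3) (# 2) ∷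
  table (# 0) (# 5) (# 1) (# 2) (# 3) (# 4) ∷ table (# 0) (# 5) (# 1) (# 2) (# 4) (# 3) ∷
  table (# 0) (# 5) (# 1) (# 3) (# 2) (# 4) ∷ table (# 0) (# 5) (# 1) (# 3) (# 4) (# 2) ∷
  table (# 0) (# 5) (# 1) (# 4) (# 2) (# 3) ∷ table (# 0) (# 5) (# 1) (# 4) (# 3) (# 2) ∷ []

rep : Fin 30 → Coloring
rep i = coloring (Vec.lookup representatives i)

-- Only rotations carrying the face of color 0 to +x, where every representative has it, are tried
-- against the representatives; this keeps the exhaustive check affordable.
RotatedRepresentative : Vec Color 6 → Set
RotatedRepresentative v = Σ[ k ∈ Fin 24 ] (∀ f → act (Vec.lookup rotations k) f ≡ (X , true) → coloring v f ≡ # 0)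
               × Σ[ i ∈ Fin 30 ] (∀ f → coloring v f ≡ rotate (Vec.lookup rotations k) (rep i) f)

rotatedRepresentative? : ∀ v → Dec (RotatedRepresentative v)
rotatedRepresentative? v =
  any? λ k → (Faces.∀? λ f → act (Vec.lookup rotations k) f Faces.≟ (X , true) →-dec coloring v f Fin.≟ # 0)
             ×-dec (any? λ i → Faces.∀? λ f → coloring v f Fin.≟ rotate (Vec.lookup rotations k) (rep i) f)

-- Opaque, since its proof term is the entire search and must not be unfolded where it is used.
opaque
  unique⇒rotatedRepresentative : ∀ v → Unique v → RotatedRepresentative v
  unique⇒rotatedRepresentative = toWitness {a? = ∀-unique? rotatedRepresentative?} _

classification : (c : Coloring) → Injective _≡_ _≡_ c → Σ[ i ∈ Fin 30 ] SameVariety (rep i) c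
classification c c-injective
  with unique⇒rotatedRepresentative (tabulate (c ∘ faceAt)) (tabulate⁺ (Faces.enum-injective ∘ c-injective))
... | k , _ , i , matches = i , Vec.lookup rotations k , λ f → trans (sym (coloring-tabulate c f)) (matches f)

Triple : Set
Triple = Color × Color × Color

infix 4 _↻_ _↻?_

data _↻_ : Triple → Triple → Set where
  ↻₀ : ∀ {a b c} → (a , b , c) ↻ (a , b , c)
  ↻₁ : ∀ {a b c} → (a , b , c) ↻ (b , c , a)
  ↻₂ : ∀ {a b c} → (a , b , c) ↻ (c , a , b)

↻-sym : ∀ {s t} → s ↻ t → t ↻ s
↻-sym ↻₀ = ↻₀
↻-sym ↻₁ = ↻₂
↻-sym ↻₂ = ↻₁

↻-trans : ∀ {s t u} → s ↻ t → t ↻ u → s ↻ u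
↻-trans ↻₀ t↻u = t↻u
↻-trans ↻₁ ↻₀ = ↻₁
↻-trans ↻₁ ↻₁ = ↻₂
↻-trans ↻₁ ↻₂ = ↻₀
↻-trans ↻₂ ↻₀ = ↻₂
↻-trans ↻₂ ↻₁ = ↻₀
↻-trans ↻₂ ↻₂ = ↻₁

_↻?_ : ∀ s t → Dec (s ↻ t)
(a , b , c) ↻? t = map′ from to (t ≟ (a , b , c) ⊎-dec t ≟ (b , c , a) ⊎-dec t ≟ (c , a , b))
  where
  _≟_ : DecidableEquality Triple
  _≟_ = ≡-dec Fin._≟_ (≡-dec Fin._≟_ Fin._≟_)
  from : t ≡ (a , b , c) ⊎ t ≡ (b , c , a) ⊎ t ≡ (c , a , b) → (a , b , c) ↻ t
  from (inj₁ refl) = ↻₀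
  from (inj₂ (inj₁ refl)) = ↻₁
  from (inj₂ (inj₂ refl)) = ↻₂
  to : (a , b , c) ↻ t → t ≡ (a , b , c) ⊎ t ≡ (b , c , a) ⊎ t ≡ (c , a , b)
  to ↻₀ = inj₁ refl
  to ↻₁ = inj₂ (inj₁ refl)
  to ↻₂ = inj₂ (inj₂ refl)

-- The colors around a corner, counterclockwise as seen from outside: (x, y, z) is counterclockwise
-- at the corner (+, +, +), and reflecting one side reverses the orientation.
vertex : Coloring → Corner → Triple
vertex c (a , b , d) = if a xor b xor d then (x , y , z) else (x , z , y)
  where
  x y z : Color
  x = c (X , a)
  y = c (Y , b)
  z = c (Z , d)

vertex-cong : ∀ {c c′} p → (∀ a → c (a , side p a) ≡ c′ (a , side p a)) → vertex c p ≡ vertex c′ p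
vertex-cong (a , b , d) h rewrite h X | h Y | h Z = refl

record SharesVertex (c d : Coloring) : Set where
  constructor sharing
  field
    {corner₁ corner₂} : Corner
    cycle : vertex c corner₁ ↻ vertex d corner₂

sharesVertex? : ∀ c d → Dec (SharesVertex c d)
sharesVertex? c d = map′ (λ (_ , _ , e) → sharing e) (λ (sharing e) → _ , _ , e)
                         (Corners.∃? λ p → Corners.∃? λ q → vertex c p ↻? vertex d q)

sharesVertex-sym : ∀ {c d} → SharesVertex c d → SharesVertex d c
sharesVertex-sym (sharing e) = sharing (↻-sym e)

sharesVertex-cong : ∀ {c c′ d} → (∀ f → c f ≡ c′ f) → SharesVertex c d → SharesVertex c′ d
sharesVertex-cong {c} {c′} c≗c′ (sharing {p} e) =
  sharing {corner₁ = p} (subst (_↻ _) (vertex-cong {c} {c′} p (λ a → c≗c′ (a , side p a))) e)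

VertexTransport : (Face → Face) → Set
VertexTransport g = ∀ p → Σ[ q ∈ Corner ] (∀ c → vertex c q ↻ vertex (c ∘ g) p)

qx-transport : VertexTransport qx
qx-transport (true , true , true) = (true , false , true) , λ _ → ↻₀
qx-transport (true , true , false) = (true , true , true) , λ _ → ↻₀
qx-transport (true , false , true) = (true , false , false) , λ _ → ↻₀
qx-transport (true , false , false) = (true , true , false) , λ _ → ↻₀
qx-transport (false , true , true) = (false , false , true) , λ _ → ↻₀
qx-transport (false , true , false) = (false , true , true) , λ _ → ↻₀
qx-transport (false , false , true) = (false , false , false) , λ _ → ↻₀
qx-transport (false , false , false) = (false , true , false) , λ _ → ↻₀

qy-transport : VertexTransport qy
qy-transport (true , true , true) = (true , true , false) , λ _ → ↻₁
qy-transport (true , true , false) = (false , true , false) , λ _ → ↻₂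
qy-transport (true , false , true) = (true , false , false) , λ _ → ↻₂
qy-transport (true , false , false) = (false , false , false) , λ _ → ↻₁
qy-transport (false , true , true) = (true , true , true) , λ _ → ↻₂
qy-transport (false , true , false) = (false , true , true) , λ _ → ↻₁
qy-transport (false , false , true) = (true , false , true) , λ _ → ↻₁
qy-transport (false , false , false) = (false , false , true) , λ _ → ↻₂

qx-order4 : ∀ f → qx (qx (qx (qx f))) ≡ f
qx-order4 (X , s) = refl
qx-order4 (Y , s) = cong (Y ,_) (not-involutive s)
qx-order4 (Z , s) = cong (Z ,_) (not-involutive s)

qy-order4 : ∀ f → qy (qy (qy (qy f))) ≡ f
qy-order4 (X , s) = cong (X ,_) (not-involutive s)
qy-order4 (Y , s) = refl
qy-order4 (Z , s) = cong (Z ,_) (not-involutive s)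

module _ (g : Face → Face) (transport : VertexTransport g) where

  sharesVertex-∘⁻ : ∀ {c d} → SharesVertex (c ∘ g) d → SharesVertex c d
  sharesVertex-∘⁻ {c} (sharing {p} e) = sharing (↻-trans (proj₂ (transport p) c) e)

  -- c agrees with c ∘ g⁴, from which three backward steps lead to c ∘ g.
  sharesVertex-∘⁺ : (∀ f → g (g (g (g f))) ≡ f) → ∀ {c d} → SharesVertex c d → SharesVertex (c ∘ g) d
  sharesVertex-∘⁺ g⁴≡id {c} {d} h = sharesVertex-∘⁻ (sharesVertex-∘⁻ (sharesVertex-∘⁻ c∘g⁴))
    where
    c∘g⁴ : SharesVertex (λ f → c (g (g (g (g f))))) d
    c∘g⁴ = sharesVertex-cong (λ f → cong c (sym (g⁴≡id f))) h

sharesVertex-rotate⁻ : ∀ r {c d} → SharesVertex (rotate r c) d → SharesVertex c d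
sharesVertex-rotate⁻ idR h = h
sharesVertex-rotate⁻ (rx r) h = sharesVertex-∘⁻ qx qx-transport (sharesVertex-rotate⁻ r h)
sharesVertex-rotate⁻ (ry r) h = sharesVertex-∘⁻ qy qy-transport (sharesVertex-rotate⁻ r h)

sharesVertex-rotate⁺ : ∀ r {c d} → SharesVertex c d → SharesVertex (rotate r c) d
sharesVertex-rotate⁺ idR h = h
sharesVertex-rotate⁺ (rx r) h = sharesVertex-rotate⁺ r (sharesVertex-∘⁺ qx qx-transport qx-order4 h)
sharesVertex-rotate⁺ (ry r) h = sharesVertex-rotate⁺ r (sharesVertex-∘⁺ qy qy-transport qy-order4 h)

module _ {A : Set} where

  count : ∀ {p} {P : Pred A p} → Decidable P → List A → ℕ
  count P? xs = sum (List.map (λ x → if does (P? x) then 1 else 0) xs)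

  count-mono : ∀ {p q} {P : Pred A p} {Q : Pred A q} (P? : Decidable P) (Q? : Decidable Q) →
               (∀ x → P x → Q x) → ∀ xs → count P? xs ≤ count Q? xs
  count-mono P? Q? P⊆Q [] = z≤n
  count-mono {P = P} {Q} P? Q? P⊆Q (x ∷ xs) = +-mono-≤ (indicator-mono (P? x) (Q? x)) (count-mono P? Q? P⊆Q xs)
    where
    indicator-mono : (x? : Dec (P x)) (y? : Dec (Q x)) → (if does x? then 1 else 0) ≤ (if does y? then 1 else 0)
    indicator-mono (no _) _ = z≤n
    indicator-mono (yes _) (yes _) = ≤-refl
    indicator-mono (yes px) (no ¬qx) = contradiction (P⊆Q x px) ¬qx

  -- Positions of xs satisfying P, renumbered consecutively.
  module _ {p} {P : Pred A p} (P? : Decidable P) where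

    rank : ∀ xs (i : Fin (length xs)) → P (List.lookup xs i) → Fin (count P? xs)
    rank (x ∷ xs) i px with P? x
    rank (x ∷ xs) zero px | yes _ = zero
    rank (x ∷ xs) (suc i) px | yes _ = suc (rank xs i px)
    rank (x ∷ xs) zero px | no ¬px = contradiction px ¬px
    rank (x ∷ xs) (suc i) px | no _ = rank xs i px

    rank-injective : ∀ xs {i j} (pi : P (List.lookup xs i)) (pj : P (List.lookup xs j)) →
                     rank xs i pi ≡ rank xs j pj → i ≡ j
    rank-injective (x ∷ xs) pi pj e with P? x
    rank-injective (x ∷ xs) {zero} {zero} pi pj e | yes _ = refl
    rank-injective (x ∷ xs) {suc i} {suc j} pi pj e | yes _ = cong suc (rank-injective xs pi pj (suc-injective e))
    rank-injective (x ∷ xs) {zero} {zero} pi pj e | no _ = refl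
    rank-injective (x ∷ xs) {suc i} {suc j} pi pj e | no _ = cong suc (rank-injective xs pi pj e)
    rank-injective (x ∷ xs) {zero} {suc _} pi pj e | no ¬px = contradiction pi ¬px
    rank-injective (x ∷ xs) {suc _} {zero} pi pj e | no ¬px = contradiction pj ¬px

    injective⇒≤count : ∀ {k} xs (sel : Fin k → Fin (length xs)) → Injective _≡_ _≡_ sel →
                       (∀ j → P (List.lookup xs (sel j))) → k ≤ count P? xs
    injective⇒≤count xs sel sel-injective sel-P =
      injective⇒≤ {f = λ j → rank xs (sel j) (sel-P j)} (sel-injective ∘ rank-injective xs (sel-P _) (sel-P _))

sum-map-+ : ∀ {A : Set} (f g : A → ℕ) xs →
            sum (List.map (λ x → f x + g x) xs) ≡ sum (List.map f xs) + sum (List.map g xs)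
sum-map-+ f g [] = refl
sum-map-+ f g (x ∷ xs) = trans (cong (f x + g x +_) (sum-map-+ f g xs)) (interchange (f x) (g x) _ _)

sum-map-swap : ∀ {A B : Set} (f : A → B → ℕ) xs ys →
               sum (List.map (λ y → sum (List.map (λ x → f x y) xs)) ys) ≡
               sum (List.map (λ x → sum (List.map (f x) ys)) xs)
sum-map-swap f [] ys = sum-map-0 ys
  where
  sum-map-0 : ∀ ys → sum (List.map (λ _ → 0) ys) ≡ 0
  sum-map-0 [] = refl
  sum-map-0 (_ ∷ ys) = sum-map-0 ys
sum-map-swap f (x ∷ xs) ys =
  trans (sum-map-+ (f x) _ ys) (cong (sum (List.map (f x) ys) +_) (sum-map-swap f xs ys))

module _ {A : Set} (f : A → ℕ) {n : ℕ} where

  *-length≤sum-map : (∀ x → n ≤ f x) → ∀ xs → n * length xs ≤ sum (List.map f xs)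
  *-length≤sum-map n≤f [] = ≤-reflexive (*-zeroʳ n)
  *-length≤sum-map n≤f (x ∷ xs) =
    ≤-trans (≤-reflexive (*-suc n (length xs))) (+-mono-≤ (n≤f x) (*-length≤sum-map n≤f xs))

  sum-map≤*-length : (∀ x → f x ≤ n) → ∀ xs → sum (List.map f xs) ≤ n * length xs
  sum-map≤*-length f≤n [] = z≤n
  sum-map≤*-length f≤n (x ∷ xs) =
    ≤-trans (+-mono-≤ (f≤n x) (sum-map≤*-length f≤n xs)) (≤-reflexive (sym (*-suc n (length xs))))

sharesVertex-variety⁻ : ∀ {a b d} → SameVariety a b → SharesVertex b d → SharesVertex a d
sharesVertex-variety⁻ (r , b≗ra) = sharesVertex-rotate⁻ r ∘ sharesVertex-cong b≗ra

sharesVertex-variety⁺ : ∀ {a b d} → SameVariety a b → SharesVertex a d → SharesVertex b d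
sharesVertex-variety⁺ (r , b≗ra) = sharesVertex-cong (sym ∘ b≗ra) ∘ sharesVertex-rotate⁺ r

placed-sharesVertex : ∀ {x big} o p → (∀ a → rotate o x (a , side p a) ≡ big (a , side p a)) →
                      SharesVertex x big
placed-sharesVertex {x} {big} o p faces = sharesVertex-rotate⁻ o (sharing {corner₁ = p} {corner₂ = p} same-vertex)
  where
  same-vertex : vertex (rotate o x) p ↻ vertex big p
  same-vertex = subst (_↻ vertex big p) (sym (vertex-cong {rotate o x} {big} p faces)) ↻₀

composable⇒8≤count : ∀ {I v} → Composable I v → 8 ≤ count (λ x → sharesVertex? (col x) (col v)) I
composable⇒8≤count {I} {v} (sel , sel-injective , orient , big , _ , faces , variety) =
  injective⇒≤count (λ x → sharesVertex? (col x) (col v)) I (sel ∘ cornerAt) (Corners.enum-injective ∘ sel-injective)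
    (cell-sharesVertex ∘ cornerAt)
  where
  cell-sharesVertex : ∀ p → SharesVertex (col (List.lookup I (sel p))) (col v)
  cell-sharesVertex p =
    sharesVertex-sym (sharesVertex-variety⁺ variety (sharesVertex-sym (placed-sharesVertex {big = big} (orient p) p (faces p))))

representative-injective : ∀ i → Injective _≡_ _≡_ (rep i)
representative-injective = toWitness {a? = all? λ i → Faces.injective? Fin._≟_ (rep i)} _

representativeCube : Fin 30 → Cube
representativeCube i = cube (rep i) (representative-injective i)

representative-sharing≤21 : ∀ i → count (λ j → sharesVertex? (rep i) (rep j)) (allFin 30) ≤ 21
representative-sharing≤21 = toWitness {a? = all? λ i → count (λ j → sharesVertex? (rep i) (rep j)) (allFin 30) ≤? 21} _

cube-sharing≤21 : ∀ x → count (λ j → sharesVertex? (col x) (rep j)) (allFin 30) ≤ 21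
cube-sharing≤21 x = ≤-trans (count-mono (sharesVertex? (col x) ∘ rep) (sharesVertex? (rep i) ∘ rep)
                                        (λ _ → sharesVertex-variety⁻ (proj₂ classified)) (allFin 30))
                            (representative-sharing≤21 i)
  where
  classified : Σ[ i ∈ Fin 30 ] SameVariety (rep i) (col x)
  classified = classification (col x) (col-injective x)
  i : Fin 30
  i = proj₁ classified

universal⇒12≤size : (I : Instance) → Universal I → 12 ≤ size I
universal⇒12≤size I universal =
  ≮⇒≥ λ size<12 → from-no (240 ≤? 231) (≤-trans 240≤21size (*-monoʳ-≤ 21 (≤-pred size<12)))
  where
  shares : Cube → Fin 30 → ℕ
  shares x j = if does (sharesVertex? (col x) (rep j)) then 1 else 0
  cubesSharing : Fin 30 → ℕ
  cubesSharing j = sum (List.map (λ x → shares x j) I)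
  representativesSharing : Cube → ℕ
  representativesSharing x = sum (List.map (shares x) (allFin 30))
  8≤cubesSharing : ∀ j → 8 ≤ cubesSharing j
  8≤cubesSharing j = composable⇒8≤count {I} {representativeCube j} (universal (representativeCube j))
  open ≤-Reasoning
  240≤21size : 240 ≤ 21 * size I
  240≤21size = begin
    8 * length (allFin 30)                   ≤⟨ *-length≤sum-map cubesSharing 8≤cubesSharing (allFin 30) ⟩
    sum (List.map cubesSharing (allFin 30))  ≡⟨ sum-map-swap shares I (allFin 30) ⟩
    sum (List.map representativesSharing I)  ≤⟨ sum-map≤*-length representativesSharing cube-sharing≤21 I ⟩
    21 * size I                              ∎

universalInstance : Instance
universalInstance =
  List.map representativeCube (# 2 ∷ # 3 ∷ # 4 ∷ # 5 ∷ # 8 ∷ # 9 ∷ # 10 ∷ # 11 ∷ # 14 ∷ # 15 ∷ # 16 ∷ # 17 ∷ [])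

-- Row i assembles representative i: for each cell, in the order of cornerAt, a cube of universalInstance
-- and an index into rotations.
assemblies : Vec (Vec (Fin 12 × Fin 24) 8) 30
assemblies =
  ((# 8 , # 1) ∷ (# 11 , # 7) ∷ (# 5 , # 1) ∷ (# 6 , # 7) ∷ (# 3 , # 0) ∷ (# 0 , # 0) ∷ (# 1 , # 1) ∷ (# 2 , # 7) ∷ []) ∷
  ((# 10 , # 1) ∷ (# 9 , # 7) ∷ (# 7 , # 1) ∷ (# 4 , # 7) ∷ (# 1 , # 0) ∷ (# 2 , # 0) ∷ (# 3 , # 1) ∷ (# 0 , # 7) ∷ []) ∷
  ((# 2 , # 0) ∷ (# 11 , # 7) ∷ (# 4 , # 0) ∷ (# 3 , # 7) ∷ (# 7 , # 23) ∷ (# 5 , # 23) ∷ (# 10 , # 20) ∷ (# 0 , # 0) ∷ []) ∷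
  ((# 10 , # 1) ∷ (# 3 , # 0) ∷ (# 6 , # 1) ∷ (# 5 , # 0) ∷ (# 4 , # 23) ∷ (# 9 , # 19) ∷ (# 2 , # 1) ∷ (# 1 , # 0) ∷ []) ∷
  ((# 0 , # 0) ∷ (# 9 , # 7) ∷ (# 6 , # 0) ∷ (# 2 , # 0) ∷ (# 5 , # 23) ∷ (# 7 , # 23) ∷ (# 8 , # 20) ∷ (# 1 , # 7) ∷ []) ∷
  ((# 8 , # 1) ∷ (# 1 , # 0) ∷ (# 4 , # 1) ∷ (# 7 , # 0) ∷ (# 6 , # 23) ∷ (# 9 , # 19) ∷ (# 0 , # 1) ∷ (# 3 , # 0) ∷ []) ∷
  ((# 11 , # 0) ∷ (# 8 , # 0) ∷ (# 1 , # 1) ∷ (# 2 , # 7) ∷ (# 7 , # 0) ∷ (# 4 , # 0) ∷ (# 5 , # 1) ∷ (# 6 , # 7) ∷ []) ∷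
  ((# 9 , # 0) ∷ (# 10 , # 0) ∷ (# 3 , # 1) ∷ (# 0 , # 7) ∷ (# 5 , # 0) ∷ (# 6 , # 0) ∷ (# 7 , # 1) ∷ (# 4 , # 7) ∷ []) ∷
  ((# 6 , # 0) ∷ (# 8 , # 0) ∷ (# 0 , # 0) ∷ (# 7 , # 7) ∷ (# 3 , # 23) ∷ (# 1 , # 23) ∷ (# 9 , # 13) ∷ (# 4 , # 0) ∷ []) ∷
  ((# 9 , # 0) ∷ (# 7 , # 0) ∷ (# 2 , # 1) ∷ (# 1 , # 0) ∷ (# 0 , # 23) ∷ (# 8 , # 2) ∷ (# 6 , # 1) ∷ (# 5 , # 0) ∷ []) ∷
  ((# 4 , # 0) ∷ (# 10 , # 0) ∷ (# 2 , # 0) ∷ (# 1 , # 7) ∷ (# 9 , # 13) ∷ (# 3 , # 23) ∷ (# 6 , # 0) ∷ (# 5 , # 7) ∷ []) ∷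
  ((# 11 , # 0) ∷ (# 5 , # 0) ∷ (# 0 , # 1) ∷ (# 3 , # 0) ∷ (# 2 , # 23) ∷ (# 8 , # 2) ∷ (# 4 , # 1) ∷ (# 7 , # 0) ∷ []) ∷
  ((# 11 , # 0) ∷ (# 8 , # 0) ∷ (# 9 , # 1) ∷ (# 10 , # 7) ∷ (# 1 , # 18) ∷ (# 2 , # 14) ∷ (# 4 , # 4) ∷ (# 7 , # 17) ∷ []) ∷
  ((# 9 , # 0) ∷ (# 10 , # 0) ∷ (# 11 , # 1) ∷ (# 8 , # 7) ∷ (# 3 , # 18) ∷ (# 0 , # 14) ∷ (# 6 , # 4) ∷ (# 5 , # 17) ∷ []) ∷
  ((# 10 , # 0) ∷ (# 4 , # 0) ∷ (# 3 , # 7) ∷ (# 0 , # 0) ∷ (# 7 , # 13) ∷ (# 2 , # 14) ∷ (# 5 , # 13) ∷ (# 8 , # 0) ∷ []) ∷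
  ((# 5 , # 0) ∷ (# 11 , # 0) ∷ (# 2 , # 1) ∷ (# 9 , # 0) ∷ (# 3 , # 18) ∷ (# 1 , # 18) ∷ (# 10 , # 1) ∷ (# 4 , # 2) ∷ []) ∷
  ((# 8 , # 0) ∷ (# 6 , # 0) ∷ (# 10 , # 0) ∷ (# 1 , # 7) ∷ (# 2 , # 14) ∷ (# 0 , # 14) ∷ (# 7 , # 13) ∷ (# 9 , # 7) ∷ []) ∷
  ((# 7 , # 0) ∷ (# 9 , # 0) ∷ (# 3 , # 0) ∷ (# 0 , # 1) ∷ (# 11 , # 0) ∷ (# 1 , # 18) ∷ (# 8 , # 1) ∷ (# 6 , # 2) ∷ []) ∷
  ((# 6 , # 0) ∷ (# 4 , # 0) ∷ (# 3 , # 3) ∷ (# 1 , # 3) ∷ (# 10 , # 13) ∷ (# 0 , # 21) ∷ (# 8 , # 15) ∷ (# 5 , # 9) ∷ []) ∷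
  ((# 9 , # 0) ∷ (# 5 , # 0) ∷ (# 11 , # 1) ∷ (# 0 , # 3) ∷ (# 2 , # 18) ∷ (# 1 , # 21) ∷ (# 7 , # 4) ∷ (# 4 , # 9) ∷ []) ∷
  ((# 10 , # 0) ∷ (# 8 , # 0) ∷ (# 2 , # 7) ∷ (# 6 , # 7) ∷ (# 3 , # 14) ∷ (# 0 , # 21) ∷ (# 4 , # 15) ∷ (# 9 , # 9) ∷ []) ∷
  ((# 9 , # 0) ∷ (# 11 , # 0) ∷ (# 7 , # 1) ∷ (# 3 , # 1) ∷ (# 1 , # 21) ∷ (# 2 , # 18) ∷ (# 8 , # 9) ∷ (# 5 , # 5) ∷ []) ∷
  ((# 10 , # 0) ∷ (# 7 , # 0) ∷ (# 1 , # 7) ∷ (# 3 , # 0) ∷ (# 6 , # 13) ∷ (# 11 , # 2) ∷ (# 5 , # 15) ∷ (# 8 , # 5) ∷ []) ∷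
  ((# 6 , # 0) ∷ (# 11 , # 0) ∷ (# 2 , # 0) ∷ (# 0 , # 1) ∷ (# 10 , # 13) ∷ (# 7 , # 2) ∷ (# 9 , # 15) ∷ (# 4 , # 5) ∷ []) ∷
  ((# 6 , # 0) ∷ (# 10 , # 0) ∷ (# 3 , # 3) ∷ (# 8 , # 7) ∷ (# 2 , # 21) ∷ (# 1 , # 14) ∷ (# 7 , # 9) ∷ (# 4 , # 17) ∷ []) ∷
  ((# 11 , # 0) ∷ (# 7 , # 0) ∷ (# 9 , # 1) ∷ (# 2 , # 3) ∷ (# 0 , # 18) ∷ (# 3 , # 21) ∷ (# 5 , # 4) ∷ (# 6 , # 9) ∷ []) ∷
  ((# 10 , # 0) ∷ (# 6 , # 0) ∷ (# 2 , # 7) ∷ (# 0 , # 7) ∷ (# 4 , # 13) ∷ (# 1 , # 14) ∷ (# 11 , # 9) ∷ (# 8 , # 17) ∷ []) ∷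
  ((# 11 , # 0) ∷ (# 9 , # 0) ∷ (# 5 , # 1) ∷ (# 1 , # 1) ∷ (# 3 , # 21) ∷ (# 0 , # 18) ∷ (# 10 , # 9) ∷ (# 7 , # 5) ∷ []) ∷
  ((# 10 , # 0) ∷ (# 7 , # 0) ∷ (# 8 , # 0) ∷ (# 5 , # 0) ∷ (# 1 , # 14) ∷ (# 3 , # 21) ∷ (# 4 , # 13) ∷ (# 9 , # 2) ∷ []) ∷
  ((# 6 , # 0) ∷ (# 11 , # 0) ∷ (# 4 , # 0) ∷ (# 9 , # 0) ∷ (# 2 , # 21) ∷ (# 0 , # 18) ∷ (# 8 , # 13) ∷ (# 5 , # 2) ∷ []) ∷ []

cellCube : Fin 30 → Corner → Fin 12
cellCube i p = proj₁ (Vec.lookup (Vec.lookup assemblies i) (cornerIndex p))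

cellRotation : Fin 30 → Corner → Rot
cellRotation i p = Vec.lookup rotations (proj₂ (Vec.lookup (Vec.lookup assemblies i) (cornerIndex p)))

cellColoring : Fin 30 → Corner → Coloring
cellColoring i p = rotate (cellRotation i p) (col (List.lookup universalInstance (cellCube i p)))

Assembles : Fin 30 → Set
Assembles i = Injective _≡_ _≡_ (cellCube i) × (∀ p a → cellColoring i p (a , side p a) ≡ rep i (a , side p a))

assemblies-correct : ∀ i → Assembles i
assemblies-correct = toWitness {a? = all? λ i →
  Corners.injective? Fin._≟_ (cellCube i) ×-dec
  (Corners.∀? λ p → Axes.∀? λ a → cellColoring i p (a , side p a) Fin.≟ rep i (a , side p a))} _

universalInstance-universal : Universal universalInstance
universalInstance-universal v =
  let (i , variety) = classification (col v) (col-injective v)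
      (cells-distinct , cells-fit) = assemblies-correct i
  in cellCube i , cells-distinct , cellRotation i , rep i , representative-injective i , cells-fit , variety

theorem4 : ((I : Instance) → Universal I → 12 ≤ size I)
    × Σ Instance (λ I → Universal I × size I ≡ 12)
theorem4 = universal⇒12≤size , universalInstance , universalInstance-universal , refl
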